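{- Let $q$ be a prime power, $n\ge 1$, $b_0,\dots,b_{n-1}\in\mathbb{F}_{q^n}$ and $\xi\in\mathbb{F}_{q^n}^*$. Define $B(x,y)=\mathrm{Tr}_{q^n/q}\bigl(\sum_{i=0}^{n-1}b_i x y^{q^i}\bigr)$ for $x,y\in\mathbb{F}_{q^n}$ and $x*y:=xy+B(x,y)\xi$. Let $M(X):=\xi\sum_{i=0}^{n-1}b_iX^{q^i}$. Then $(\mathbb{F}_{q^n},+,*)$ is a presemifield if and only if $\mathrm{Tr}_{q^n/q}(M(a)/a)\neq -1$ for every $a\in\mathbb{F}_{q^n}^*$.
   Context: $\mathrm{Tr}_{q^n/q}$ denotes the trace map from $\mathbb{F}_{q^n}$ to $\mathbb{F}_q$. A presemifield is a set with two operations $+,*$ such that $(\mathbb{S},+)$ is a group with identity $0$, both distributive laws hold, $0*a=a*0=0$ for all $a$, and $(\mathbb{S}\setminus\{0\},*)$ is a quasigroup (for finite $\mathbb{S}$ with distributive laws this is equivalent to: $x*y=0$ implies $x=0$ or $y=0$); no multiplicative identity is required. -}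

module Defs where

open import Level using (Level; _⊔_) renaming (suc to lsuc)
open import Data.Nat using (ℕ; zero; suc) renaming (_^_ to _^ℕ_)
open import Data.Fin using (Fin)
import Data.Fin as F
open import Data.Product using (Σ; _×_; _,_)
open import Function.Bundles using (_↔_)
open import Relation.Binary.PropositionalEquality using (_≡_; _≢_)
open import Algebra.Structures using (IsCommutativeRing)

record FiniteField (c : Level) : Set (lsuc c) where
  infixl 7 _*_
  infixl 6 _+_
  field
    Carrier : Set c
    _+_ _*_ : Carrier → Carrier → Carrier
    -_ : Carrier → Carrier
    0# 1# : Carrier
    isCommutativeRing : IsCommutativeRing _≡_ _+_ _*_ -_ 0# 1#
    0≢1 : 0# ≢ 1#
    _⁻¹ : Carrier → Carrier
    ⁻¹-inverse : ∀ x → x ≢ 0# → x * (x ⁻¹) ≡ 1#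
    size : ℕ
    enumeration : Carrier ↔ Fin size

module FieldOps {c : Level} (K : FiniteField c) where
  open FiniteField K

  _^_ : Carrier → ℕ → Carrier
  x ^ zero = 1#
  x ^ suc m = x * (x ^ m)

  sumK : (n : ℕ) → (Fin n → Carrier) → Carrier
  sumK zero f = 0#
  sumK (suc n) f = f F.zero + sumK n (λ i → f (F.suc i))

  Tr : (q n : ℕ) → Carrier → Carrier
  Tr q n x = sumK n (λ i → x ^ (q ^ℕ F.toℕ i))

record IsPresemifield {c : Level} (K : FiniteField c)
    (_⋆_ : FiniteField.Carrier K → FiniteField.Carrier K → FiniteField.Carrier K)
    : Set c where
  open FiniteField K
  field
    distribˡ : ∀ x y z → x ⋆ (y + z) ≡ (x ⋆ y) + (x ⋆ z)
    distribʳ : ∀ x y z → (y + z) ⋆ x ≡ (y ⋆ x) + (z ⋆ x)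
    zeroˡ : ∀ a → 0# ⋆ a ≡ 0#
    zeroʳ : ∀ a → a ⋆ 0# ≡ 0#
    closed : ∀ a b → a ≢ 0# → b ≢ 0# → (a ⋆ b) ≢ 0#
    leftDiv : ∀ a b → a ≢ 0# → b ≢ 0# →
      Σ Carrier (λ x → x ≢ 0# × (a ⋆ x ≡ b) ×
        (∀ x' → x' ≢ 0# → a ⋆ x' ≡ b → x' ≡ x))
    rightDiv : ∀ a b → a ≢ 0# → b ≢ 0# →
      Σ Carrier (λ y → y ≢ 0# × (y ⋆ a ≡ b) ×
        (∀ y' → y' ≢ 0# → y' ⋆ a ≡ b → y' ≡ y))

module Submission where

-- 1. Finite field theory from the bare axioms of a finite field K:
--    the prime p is the characteristic (|K|·1 = 0 by summing x ↦ 1 + x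
--    over K), the Frobenius x ↦ x^p is additive (p divides the inner
--    binomial coefficients), Fermat's theorem a^|K| = a (multiply
--    a·g over all g), and an injective additive map of K is onto.
-- 2. The trace Tr = Σ_{i<n} x^{q^i} is additive, F_q-linear and
--    F_q-valued (F_q = the fixed points of x ↦ x^q), so B is biadditive,
--    F_q-valued and F_q-linear in its second argument.
-- 3. For ANY such form B the twisted product x ⋆ y = xy + B(x,y)ξ is a
--    presemifield iff B(ξ/a, a) ≠ -1 for all a ≠ 0: if a ⋆ y = 0 then
--    y = -B(a,y)·ξ/a, and F_q-linearity forces B(a, ξ/a) = -1.
--
-- Since Tr(M(a)/a) = B(ξ/a, a), the theorem is layer 3 applied to layer 2.

open import Defs
open import Level using (Level)
open import Data.Nat as ℕ using (ℕ; zero; suc; _≥_; _<_; s≤s) renaming (_^_ to _^ℕ_)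
import Data.Nat.Properties as ℕP
open import Data.Nat.Primality using (Prime; euclidsLemma; ¬prime[0])
open import Data.Nat.Divisibility using (_∣_; divides; ∣⇒≤)
open import Data.Nat.Combinatorics using (_C_; nC1≡n; nCn≡1; nCk+nC[k+1]≡[n+1]C[k+1])
open import Data.Nat.Solver using (module +-*-Solver)
open import Data.Fin as F using (Fin; toℕ)
import Data.Fin.Properties as FP
open import Data.Vec.Functional using (init)
open import Data.Maybe using (nothing)
open import Data.Product using (Σ; _×_; _,_; ∃)
open import Data.Sum using (inj₁; inj₂)
open import Data.Empty using (⊥-elim)
open import Relation.Nullary using (Dec; yes; no)
open import Function.Base using (_∘_)
open import Function.Bundles using (_⇔_; _↔_; Inverse; mk⇔; mk↔ₛ′)
open import Function.Construct.Composition using (_↔-∘_)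
open import Function.Construct.Symmetry using (↔-sym)
open import Relation.Binary.PropositionalEquality
open import Algebra.Bundles using (CommutativeRing; CommutativeMonoid)
open import Algebra.Structures using (IsCommutativeMonoid)
open import Tactic.RingSolver.Core.AlmostCommutativeRing using (fromCommutativeRing)
import Tactic.RingSolver.NonReflective
import Algebra.Properties.Ring
import Algebra.Properties.CommutativeSemigroup
import Algebra.Properties.Semiring.Mult
import Algebra.Properties.Semiring.Exp
import Algebra.Properties.CommutativeSemiring.Binomial
import Algebra.Properties.CommutativeMonoid.Sum
import Algebra.Properties.Semiring.Sum

module PrimeBinomial where
  open +-*-Solver using (solve; _:+_; _:*_; _:=_; con)
  open ≡-Reasoning

  absorption : ∀ n k → suc k ℕ.* (suc n C suc k) ≡ suc n ℕ.* (n C k)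
  absorption zero zero = refl
  absorption zero (suc k) = ℕP.*-zeroʳ (suc (suc k))
  absorption (suc n) zero = trans (ℕP.+-identityʳ _) (trans (nC1≡n (suc (suc n))) (sym (ℕP.*-identityʳ (suc (suc n)))))
  absorption (suc n) (suc j) = begin
    suc (suc j) ℕ.* (suc (suc n) C suc (suc j))
      ≡⟨ cong (suc (suc j) ℕ.*_) (sym (nCk+nC[k+1]≡[n+1]C[k+1] (suc n) (suc j))) ⟩
    suc (suc j) ℕ.* (A ℕ.+ A′)
      ≡⟨ solve 3 (λ j a b → (con 2 :+ j) :* (a :+ b) := a :+ ((con 1 :+ j) :* a) :+ ((con 2 :+ j) :* b)) refl j A A′ ⟩
    A ℕ.+ suc j ℕ.* A ℕ.+ suc (suc j) ℕ.* A′
      ≡⟨ cong₂ (λ u v → A ℕ.+ u ℕ.+ v) (absorption n j) (absorption n (suc j)) ⟩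
    A ℕ.+ suc n ℕ.* (n C j) ℕ.+ suc n ℕ.* (n C suc j)
      ≡⟨ solve 4 (λ a m u v → a :+ m :* u :+ m :* v := a :+ m :* (u :+ v)) refl A (suc n) (n C j) (n C suc j) ⟩
    A ℕ.+ suc n ℕ.* (n C j ℕ.+ n C suc j)
      ≡⟨ cong (λ z → A ℕ.+ suc n ℕ.* z) (nCk+nC[k+1]≡[n+1]C[k+1] n j) ⟩
    A ℕ.+ suc n ℕ.* A ∎
    where
    A = suc n C suc j
    A′ = suc n C suc (suc j)

  -- Since (j+1)·C(p,j+1) = p·C(p-1,j) and p does not divide j+1 < p.
  prime∣binomial : ∀ m j → Prime (suc m) → j < m → suc m ∣ (suc m C suc j)
  prime∣binomial m j p-prime j<m
    with euclidsLemma (suc j) (suc m C suc j) p-prime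
           (divides (m C j) (trans (absorption m j) (ℕP.*-comm (suc m) (m C j))))
  ... | inj₂ p∣C = p∣C
  ... | inj₁ p∣j+1 = ⊥-elim (ℕP.<-irrefl refl (ℕP.≤-trans (s≤s (∣⇒≤ p∣j+1)) (s≤s j<m)))

module FieldTheory {c : Level} (K : FiniteField c) where
  open FiniteField K
  open FieldOps K
  open ≡-Reasoning

  commutativeRing : CommutativeRing c c
  commutativeRing = record { isCommutativeRing = isCommutativeRing }

  open CommutativeRing commutativeRing using
    ( +-assoc; +-comm; *-assoc; *-comm; +-identityˡ; +-identityʳ
    ; *-identityˡ; *-identityʳ; -‿inverseˡ; -‿inverseʳ; distribˡ
    ; distribʳ; zeroˡ; zeroʳ; ring; semiring; commutativeSemiring
    ; +-isCommutativeMonoid; *-isCommutativeMonoid; *-commutativeSemigroup )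
  open Algebra.Properties.Ring ring using
    (+-cancelˡ; +-cancelʳ; +-inverseˡ-unique; x∙y⁻¹≈ε⇒x≈y; -1*x≈-x; -‿distribˡ-*; -0#≈0#)
  open Algebra.Properties.CommutativeSemigroup *-commutativeSemigroup using (interchange; xy∙z≈y∙xz; x∙yz≈y∙xz; xy∙z≈xz∙y)
  open Tactic.RingSolver.NonReflective (fromCommutativeRing commutativeRing (λ _ → nothing))
    using (solve; _⊜_; _⊕_; _⊗_)
  module Mult = Algebra.Properties.Semiring.Mult semiring
  open Mult using () renaming (_×_ to _·_)

  open Inverse enumeration using (strictlyInverseˡ; strictlyInverseʳ)
    renaming (to to index; from to element)

  index-injective : ∀ {x y} → index x ≡ index y → x ≡ y
  index-injective {x} {y} e = trans (sym (strictlyInverseʳ x)) (trans (cong element e) (strictlyInverseʳ y))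

  _≟_ : (x y : Carrier) → Dec (x ≡ y)
  x ≟ y with index x F.≟ index y
  ... | yes e = yes (index-injective e)
  ... | no ne = no (ne ∘ cong index)

  1≢0 : 1# ≢ 0#
  1≢0 = 0≢1 ∘ sym

  *-⁻¹-cancel : ∀ x y → x ≢ 0# → y * x * x ⁻¹ ≡ y
  *-⁻¹-cancel x y x≢0 = begin
    y * x * x ⁻¹   ≡⟨ *-assoc y x (x ⁻¹) ⟩
    y * (x * x ⁻¹) ≡⟨ cong (y *_) (⁻¹-inverse x x≢0) ⟩
    y * 1#         ≡⟨ *-identityʳ y ⟩
    y              ∎

  ⁻¹-*-cancel : ∀ x y → x ≢ 0# → y * x ⁻¹ * x ≡ y
  ⁻¹-*-cancel x y x≢0 = begin
    y * x ⁻¹ * x   ≡⟨ *-assoc y (x ⁻¹) x ⟩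
    y * (x ⁻¹ * x) ≡⟨ cong (y *_) (trans (*-comm (x ⁻¹) x) (⁻¹-inverse x x≢0)) ⟩
    y * 1#         ≡⟨ *-identityʳ y ⟩
    y              ∎

  *-cancelˡ : ∀ {x y} z → z ≢ 0# → z * x ≡ z * y → x ≡ y
  *-cancelˡ {x} {y} z z≢0 e = begin
    x              ≡⟨ sym (*-⁻¹-cancel z x z≢0) ⟩
    x * z * z ⁻¹   ≡⟨ cong (λ w → w * z ⁻¹) (trans (*-comm x z) e) ⟩
    z * y * z ⁻¹   ≡⟨ cong (λ w → w * z ⁻¹) (*-comm z y) ⟩
    y * z * z ⁻¹   ≡⟨ *-⁻¹-cancel z y z≢0 ⟩
    y              ∎

  no-zero-divisors : ∀ {x y} → x ≢ 0# → y ≢ 0# → x * y ≢ 0#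
  no-zero-divisors {x} x≢0 y≢0 xy≡0 = y≢0 (*-cancelˡ x x≢0 (trans xy≡0 (sym (zeroʳ x))))

  ⁻¹-nonzero : ∀ x → x ≢ 0# → x ⁻¹ ≢ 0#
  ⁻¹-nonzero x x≢0 x⁻¹≡0 = 1≢0 (trans (sym (⁻¹-inverse x x≢0)) (trans (cong (x *_) x⁻¹≡0) (zeroʳ x)))

  ratio-inverse : ∀ x y → x ≢ 0# → y ≢ 0# → x * (x * y ⁻¹) ⁻¹ ≡ y
  ratio-inverse x y x≢0 y≢0 = begin
    x * r ⁻¹       ≡⟨ cong (λ w → w * r ⁻¹) (sym (⁻¹-*-cancel y x y≢0)) ⟩
    r * y * r ⁻¹   ≡⟨ cong (λ w → w * r ⁻¹) (*-comm r y) ⟩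
    y * r * r ⁻¹   ≡⟨ *-⁻¹-cancel r y (no-zero-divisors x≢0 (⁻¹-nonzero y y≢0)) ⟩
    y              ∎
    where
    r : Carrier
    r = x * y ⁻¹

  IsAdditive : (Carrier → Carrier) → Set c
  IsAdditive f = ∀ u v → f (u + v) ≡ f u + f v

  additive-zero : ∀ f → IsAdditive f → f 0# ≡ 0#
  additive-zero f f-additive = +-cancelˡ (f 0#) (f 0#) 0# (begin
    f 0# + f 0#  ≡⟨ sym (f-additive 0# 0#) ⟩
    f (0# + 0#)  ≡⟨ cong f (+-identityʳ 0#) ⟩
    f 0#         ≡⟨ sym (+-identityʳ (f 0#)) ⟩
    f 0# + 0#    ∎)

  additive-neg : ∀ f → IsAdditive f → ∀ x → f (- x) ≡ - f x
  additive-neg f f-additive x = +-inverseˡ-unique (f (- x)) (f x) (begin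
    f (- x) + f x  ≡⟨ sym (f-additive (- x) x) ⟩
    f (- x + x)    ≡⟨ cong f (-‿inverseˡ x) ⟩
    f 0#           ≡⟨ additive-zero f f-additive ⟩
    0#             ∎)

  ^-+ : ∀ x m n → x ^ (m ℕ.+ n) ≡ x ^ m * x ^ n
  ^-+ x zero n = sym (*-identityˡ _)
  ^-+ x (suc m) n = trans (cong (x *_) (^-+ x m n)) (sym (*-assoc _ _ _))

  *-^ : ∀ x y n → (x * y) ^ n ≡ x ^ n * y ^ n
  *-^ x y zero = sym (*-identityˡ 1#)
  *-^ x y (suc n) = trans (cong ((x * y) *_) (*-^ x y n)) (interchange x y (x ^ n) (y ^ n))

  1^ : ∀ n → 1# ^ n ≡ 1#
  1^ zero = refl
  1^ (suc n) = trans (*-identityˡ _) (1^ n)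

  ^-* : ∀ x m n → x ^ (m ℕ.* n) ≡ (x ^ m) ^ n
  ^-* x zero n = sym (1^ n)
  ^-* x (suc m) n = begin
    x ^ (n ℕ.+ m ℕ.* n)     ≡⟨ ^-+ x n (m ℕ.* n) ⟩
    x ^ n * x ^ (m ℕ.* n)   ≡⟨ cong (x ^ n *_) (^-* x m n) ⟩
    x ^ n * (x ^ m) ^ n     ≡⟨ sym (*-^ x (x ^ m) n) ⟩
    (x * x ^ m) ^ n         ∎

  ^-nonzero : ∀ x n → x ≢ 0# → x ^ n ≢ 0#
  ^-nonzero x zero x≢0 = 1≢0
  ^-nonzero x (suc n) x≢0 = no-zero-divisors x≢0 (^-nonzero x n x≢0)

  ^≡0⇒≡0 : ∀ x n → x ^ n ≡ 0# → x ≡ 0#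
  ^≡0⇒≡0 x n xⁿ≡0 with x ≟ 0#
  ... | yes x≡0 = x≡0
  ... | no x≢0 = ⊥-elim (^-nonzero x n x≢0 xⁿ≡0)

  -- The power agrees with the library's exponentiation, for which the binomial theorem is proved.
  module Exp = Algebra.Properties.Semiring.Exp semiring

  ^≡Exp^ : ∀ x n → x ^ n ≡ x Exp.^ n
  ^≡Exp^ x zero = refl
  ^≡Exp^ x (suc n) = cong (x *_) (^≡Exp^ x n)

  module FoldAll {_∙_ : Carrier → Carrier → Carrier} {ε : Carrier}
                 (isCommutativeMonoid : IsCommutativeMonoid _≡_ _∙_ ε) where
    commutativeMonoid : CommutativeMonoid c c
    commutativeMonoid = record { isCommutativeMonoid = isCommutativeMonoid }

    open CommutativeMonoid commutativeMonoid using (identityˡ; identityʳ)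
    open Algebra.Properties.CommutativeMonoid.Sum commutativeMonoid public

    fold : (Carrier → Carrier) → Carrier
    fold g = sum (λ i → g (element i))

    fold-invariant : (σ : Carrier ↔ Carrier) (g : Carrier → Carrier) →
      fold g ≡ fold (g ∘ Inverse.to σ)
    fold-invariant σ g = begin
      fold g                                             ≡⟨ ∑-permute (g ∘ element) π ⟩
      sum (λ i → g (element (index (to σ (element i))))) ≡⟨ sum-cong-≗ (λ i → cong g (strictlyInverseʳ (to σ (element i)))) ⟩
      fold (g ∘ to σ)                                    ∎
      where
      open Inverse using (to)
      π : Fin size ↔ Fin size
      π = enumeration ↔-∘ (σ ↔-∘ ↔-sym enumeration)

    sum-single : ∀ n (f : Fin n → Carrier) j → (∀ i → i ≢ j → f i ≡ ε) → sum f ≡ f j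
    sum-single (suc n) f F.zero others = begin
      f F.zero ∙ sum (f ∘ F.suc) ≡⟨ cong (f F.zero ∙_) (trans (sum-cong-≗ (λ i → others (F.suc i) λ ())) (sum-replicate-zero n)) ⟩
      f F.zero ∙ ε               ≡⟨ identityʳ _ ⟩
      f F.zero                   ∎
    sum-single (suc n) f (F.suc j) others = begin
      f F.zero ∙ sum (f ∘ F.suc) ≡⟨ cong₂ _∙_ (others F.zero λ ()) (sum-single n (f ∘ F.suc) j (λ i i≢j → others (F.suc i) (i≢j ∘ FP.suc-injective))) ⟩
      ε ∙ f (F.suc j)            ≡⟨ identityˡ _ ⟩
      f (F.suc j)                ∎

    fold-single : ∀ g x₀ → (∀ x → x ≢ x₀ → g x ≡ ε) → fold g ≡ g x₀
    fold-single g x₀ others = begin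
      fold g                     ≡⟨ sum-single size (g ∘ element) (index x₀) (λ i i≢ → others (element i) (i≢ ∘ element≡⇒index≡ i)) ⟩
      g (element (index x₀))     ≡⟨ cong g (strictlyInverseʳ x₀) ⟩
      g x₀                       ∎
      where
      element≡⇒index≡ : ∀ i → element i ≡ x₀ → i ≡ index x₀
      element≡⇒index≡ i e = trans (sym (strictlyInverseˡ i)) (cong index e)

  module ΣK = FoldAll +-isCommutativeMonoid
  module ΠK = FoldAll *-isCommutativeMonoid
  open ΣK using (sum)

  sumK≡sum : ∀ n (f : Fin n → Carrier) → sumK n f ≡ sum f
  sumK≡sum zero f = refl
  sumK≡sum (suc n) f = cong (f F.zero +_) (sumK≡sum n (f ∘ F.suc))

  sumK-cong : ∀ n {f g : Fin n → Carrier} → (∀ i → f i ≡ g i) → sumK n f ≡ sumK n g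
  sumK-cong n {f} {g} f≗g = trans (sumK≡sum n f) (trans (ΣK.sum-cong-≗ f≗g) (sym (sumK≡sum n g)))

  sumK-+ : ∀ n (f g : Fin n → Carrier) → sumK n (λ i → f i + g i) ≡ sumK n f + sumK n g
  sumK-+ n f g = trans (sumK≡sum n _) (trans (ΣK.∑-distrib-+ f g) (sym (cong₂ _+_ (sumK≡sum n f) (sumK≡sum n g))))

  *-sumK : ∀ n a (f : Fin n → Carrier) → a * sumK n f ≡ sumK n (λ i → a * f i)
  *-sumK n a f = trans (cong (a *_) (sumK≡sum n f)) (trans (Sum.*-distribˡ-sum a f) (sym (sumK≡sum n _)))
    where module Sum = Algebra.Properties.Semiring.Sum semiring

  sumK-rotate : ∀ n (g : ℕ → Carrier) → sumK n (g ∘ toℕ) + g n ≡ g 0 + sumK n (g ∘ suc ∘ toℕ)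
  sumK-rotate zero g = +-comm 0# (g 0)
  sumK-rotate (suc n) g = trans (+-assoc _ _ _) (cong (g 0 +_) (sumK-rotate n (g ∘ suc)))

  additive-sumK : ∀ f → IsAdditive f → ∀ n (g : Fin n → Carrier) → f (sumK n g) ≡ sumK n (f ∘ g)
  additive-sumK f f-additive zero g = additive-zero f f-additive
  additive-sumK f f-additive (suc n) g = trans (f-additive _ _) (cong (f (g F.zero) +_) (additive-sumK f f-additive n (g ∘ F.suc)))

  translation : Carrier → Carrier ↔ Carrier
  translation t = mk↔ₛ′ (t +_) (- t +_)
    (λ x → trans (sym (+-assoc t (- t) x)) (trans (cong (_+ x) (-‿inverseʳ t)) (+-identityˡ x)))
    (λ x → trans (sym (+-assoc (- t) t x)) (trans (cong (_+ x) (-‿inverseˡ t)) (+-identityˡ x)))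

  -- |K|·1 = 0: translating by 1 permutes K, so Σ_x (1 + x) = Σ_x x.
  size·1≡0 : size · 1# ≡ 0#
  size·1≡0 = +-cancelʳ S (size · 1#) 0# (begin
    size · 1# + S                  ≡⟨ cong (_+ S) (sym (ΣK.sum-replicate size)) ⟩
    ΣK.fold (λ _ → 1#) + S         ≡⟨ sym (ΣK.∑-distrib-+ (λ _ → 1#) element) ⟩
    ΣK.fold (1# +_)                ≡⟨ sym (ΣK.fold-invariant (translation 1#) (λ x → x)) ⟩
    S                              ≡⟨ sym (+-identityˡ S) ⟩
    0# + S                         ∎)
    where
    S : Carrier
    S = ΣK.fold (λ x → x)

  -- If |K| = p^e then p·1 = 0, since (p·1)^e = |K|·1 = 0 and K has no zero divisors.
  characteristic : ∀ p e → size ≡ p ^ℕ e → p · 1# ≡ 0#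
  characteristic p e size≡pᵉ = ^≡0⇒≡0 (p · 1#) e (begin
    (p · 1#) ^ e     ≡⟨ sym (·1-^ e) ⟩
    (p ^ℕ e) · 1#    ≡⟨ cong (_· 1#) (sym size≡pᵉ) ⟩
    size · 1#        ≡⟨ size·1≡0 ⟩
    0#               ∎)
    where
    ·1-^ : ∀ e → (p ^ℕ e) · 1# ≡ (p · 1#) ^ e
    ·1-^ zero = +-identityʳ 1#
    ·1-^ (suc e) = trans (Mult.×1-homo-* p (p ^ℕ e)) (cong ((p · 1#) *_) (·1-^ e))

  multiple-of-characteristic : ∀ {p m} → p · 1# ≡ 0# → p ∣ m → ∀ z → m · z ≡ 0#
  multiple-of-characteristic {p} p·1≡0 (divides d refl) z = begin
    (d ℕ.* p) · z                ≡⟨ cong ((d ℕ.* p) ·_) (sym (*-identityˡ z)) ⟩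
    (d ℕ.* p) · (1# * z)         ≡⟨ sym (Mult.×-assoc-* (d ℕ.* p) 1# z) ⟩
    ((d ℕ.* p) · 1#) * z         ≡⟨ cong (_* z) (Mult.×1-homo-* d p) ⟩
    ((d · 1#) * (p · 1#)) * z    ≡⟨ cong (λ w → (d · 1#) * w * z) p·1≡0 ⟩
    ((d · 1#) * 0#) * z          ≡⟨ trans (cong (_* z) (zeroʳ _)) (zeroˡ z) ⟩
    0#                           ∎

  Additive : ℕ → Set c
  Additive e = IsAdditive (_^ e)

  -- Frobenius: in characteristic p, x ↦ x^p is additive, because every inner
  -- term of the binomial expansion carries a coefficient C(p,j) divisible by p.
  frobenius : ∀ p → Prime p → p · 1# ≡ 0# → Additive p
  frobenius zero p-prime _ = ⊥-elim (¬prime[0] p-prime)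
  frobenius (suc m) p-prime p·1≡0 x y = begin
    (x + y) ^ suc m
      ≡⟨ ^≡Exp^ (x + y) (suc m) ⟩
    (x + y) Exp.^ suc m
      ≡⟨ Binomial.theorem (suc m) x y ⟩
    term F.zero + sum inner+last
      ≡⟨ cong (term F.zero +_) (ΣK.sum-init-last inner+last) ⟩
    term F.zero + (sum (init inner+last) + term (F.suc (F.fromℕ m)))
      ≡⟨ cong₂ (λ u v → term F.zero + (u + v)) inner-terms-vanish last-term ⟩
    term F.zero + (0# + x Exp.^ suc m)
      ≡⟨ cong₂ _+_ first-term (+-identityˡ _) ⟩
    y Exp.^ suc m + x Exp.^ suc m
      ≡⟨ +-comm _ _ ⟩
    x Exp.^ suc m + y Exp.^ suc m
      ≡⟨ sym (cong₂ _+_ (^≡Exp^ x (suc m)) (^≡Exp^ y (suc m))) ⟩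
    x ^ suc m + y ^ suc m ∎
    where
    module Binomial = Algebra.Properties.CommutativeSemiring.Binomial commutativeSemiring
    term : Fin (suc (suc m)) → Carrier
    term = Binomial.binomialTerm x y (suc m)
    inner+last : Fin (suc m) → Carrier
    inner+last = term ∘ F.suc
    first-term : term F.zero ≡ y Exp.^ suc m
    first-term = trans (+-identityʳ _) (*-identityˡ _)
    last-term : term (F.suc (F.fromℕ m)) ≡ x Exp.^ suc m
    last-term rewrite FP.toℕ-fromℕ m | nCn≡1 (suc m) | ℕP.n∸n≡0 m = trans (+-identityʳ _) (*-identityʳ _)
    inner-terms-vanish : sum (init inner+last) ≡ 0#
    inner-terms-vanish = trans (ΣK.sum-cong-≗ inner-term-vanishes) (ΣK.sum-replicate-zero m)
      where
      inner-term-vanishes : ∀ i → init inner+last i ≡ 0#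
      inner-term-vanishes i = multiple-of-characteristic p·1≡0
        (subst (λ j → suc m ∣ (suc m C suc j)) (sym (FP.toℕ-inject₁ i))
          (PrimeBinomial.prime∣binomial m (toℕ i) p-prime (FP.toℕ<n i))) _

  additive-power : ∀ {a} → Additive a → ∀ j → Additive (a ^ℕ j)
  additive-power {a} a-additive zero x y = trans (*-identityʳ _) (sym (cong₂ _+_ (*-identityʳ x) (*-identityʳ y)))
  additive-power {a} a-additive (suc j) x y = begin
    (x + y) ^ (a ℕ.* a ^ℕ j)           ≡⟨ ^-* (x + y) a (a ^ℕ j) ⟩
    ((x + y) ^ a) ^ (a ^ℕ j)           ≡⟨ cong (_^ (a ^ℕ j)) (a-additive x y) ⟩
    (x ^ a + y ^ a) ^ (a ^ℕ j)         ≡⟨ additive-power a-additive j (x ^ a) (y ^ a) ⟩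
    (x ^ a) ^ (a ^ℕ j) + (y ^ a) ^ (a ^ℕ j) ≡⟨ sym (cong₂ _+_ (^-* x a (a ^ℕ j)) (^-* y a (a ^ℕ j))) ⟩
    x ^ (a ℕ.* a ^ℕ j) + y ^ (a ℕ.* a ^ℕ j) ∎

  fixed-power : ∀ {μ a} → μ ^ a ≡ μ → ∀ j → μ ^ (a ^ℕ j) ≡ μ
  fixed-power {μ} μ-fixed zero = *-identityʳ μ
  fixed-power {μ} {a} μ-fixed (suc j) = trans (^-* μ a (a ^ℕ j)) (trans (cong (_^ (a ^ℕ j)) μ-fixed) (fixed-power μ-fixed j))

  nonzeroPart : Carrier → Carrier
  nonzeroPart g with g ≟ 0#
  ... | yes _ = 1#
  ... | no _ = g

  -- The factor by which nonzeroPart fails to be multiplicative: a at 0, 1 elsewhere.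
  zeroCorrection : Carrier → Carrier → Carrier
  zeroCorrection a g with g ≟ 0#
  ... | yes _ = a
  ... | no _ = 1#

  nonzeroPart-nonzero : ∀ g → nonzeroPart g ≢ 0#
  nonzeroPart-nonzero g with g ≟ 0#
  ... | yes _ = 1≢0
  ... | no g≢0 = g≢0

  nonzeroPart-scale : ∀ a g → a ≢ 0# → a * nonzeroPart g ≡ nonzeroPart (a * g) * zeroCorrection a g
  nonzeroPart-scale a g a≢0 with g ≟ 0# | (a * g) ≟ 0#
  ... | yes _ | yes _ = trans (*-identityʳ a) (sym (*-identityˡ a))
  ... | yes g≡0 | no ag≢0 = ⊥-elim (ag≢0 (trans (cong (a *_) g≡0) (zeroʳ a)))
  ... | no g≢0 | yes ag≡0 = ⊥-elim (no-zero-divisors a≢0 g≢0 ag≡0)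
  ... | no _ | no _ = sym (*-identityʳ _)

  zeroCorrection-product : ∀ a → ΠK.fold (zeroCorrection a) ≡ a
  zeroCorrection-product a = trans (ΠK.fold-single (zeroCorrection a) 0# elsewhere) at-zero
    where
    at-zero : zeroCorrection a 0# ≡ a
    at-zero with 0# ≟ 0#
    ... | yes _ = refl
    ... | no 0≢0 = ⊥-elim (0≢0 refl)
    elsewhere : ∀ g → g ≢ 0# → zeroCorrection a g ≡ 1#
    elsewhere g g≢0 with g ≟ 0#
    ... | yes g≡0 = ⊥-elim (g≢0 g≡0)
    ... | no _ = refl

  product-nonzero : ∀ n (f : Fin n → Carrier) → (∀ i → f i ≢ 0#) → ΠK.sum f ≢ 0#
  product-nonzero zero f _ = 1≢0
  product-nonzero (suc n) f f≢0 = no-zero-divisors (f≢0 F.zero) (product-nonzero n (f ∘ F.suc) (f≢0 ∘ F.suc))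

  product-const : ∀ n a → ΠK.sum {n} (λ _ → a) ≡ a ^ n
  product-const zero a = refl
  product-const (suc n) a = cong (a *_) (product-const n a)

  scaling : ∀ a → a ≢ 0# → Carrier ↔ Carrier
  scaling a a≢0 = mk↔ₛ′ (a *_) (a ⁻¹ *_)
    (λ x → trans (cong (a *_) (*-comm (a ⁻¹) x)) (trans (*-comm a _) (⁻¹-*-cancel a x a≢0)))
    (λ x → trans (cong (a ⁻¹ *_) (*-comm a x)) (trans (*-comm (a ⁻¹) _) (*-⁻¹-cancel a x a≢0)))

  -- Fermat: a^|K| = a.  For a ≠ 0, multiplying by a permutes K; comparing
  -- the products U of the nonzero parts of g and of a·g over all g ∈ K
  -- gives a^|K|·U = U·a with U ≠ 0.
  fermat : ∀ a → a ^ size ≡ a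
  fermat a with a ≟ 0#
  ... | yes refl = 0^nonempty (index 0#)
    where
    0^nonempty : ∀ {n} → Fin n → 0# ^ n ≡ 0#
    0^nonempty {suc n} _ = zeroˡ _
  ... | no a≢0 = *-cancelˡ U U≢0 (begin
    U * a ^ size                                     ≡⟨ *-comm U _ ⟩
    a ^ size * U                                     ≡⟨ cong (_* U) (sym (product-const size a)) ⟩
    ΠK.fold (λ _ → a) * U                            ≡⟨ sym (ΠK.∑-distrib-+ (λ _ → a) (nonzeroPart ∘ element)) ⟩
    ΠK.fold (λ g → a * nonzeroPart g)                ≡⟨ ΠK.sum-cong-≗ (λ i → nonzeroPart-scale a (element i) a≢0) ⟩
    ΠK.fold (λ g → nonzeroPart (a * g) * zeroCorrection a g)
      ≡⟨ ΠK.∑-distrib-+ (nonzeroPart ∘ (a *_) ∘ element) (zeroCorrection a ∘ element) ⟩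
    ΠK.fold (nonzeroPart ∘ (a *_)) * ΠK.fold (zeroCorrection a)
      ≡⟨ cong₂ _*_ (sym (ΠK.fold-invariant (scaling a a≢0) nonzeroPart)) (zeroCorrection-product a) ⟩
    U * a                                            ∎)
    where
    U : Carrier
    U = ΠK.fold nonzeroPart
    U≢0 : U ≢ 0#
    U≢0 = product-nonzero size (nonzeroPart ∘ element) (nonzeroPart-nonzero ∘ element)

  fin-injective⇒surjective : ∀ n (g : Fin n → Fin n) → (∀ {i j} → g i ≡ g j → i ≡ j) → ∀ j → ∃ λ i → g i ≡ j
  fin-injective⇒surjective (suc m) g g-injective j with FP.any? (λ i → g i F.≟ j)
  ... | yes hit = hit
  ... | no miss with FP.pigeonhole (ℕP.n<1+n m) (λ i → F.punchOut {i = j} (λ e → miss (i , sym e)))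
  ...   | i , i′ , i<i′ , e = ⊥-elim (FP.<-irrefl
          (g-injective (FP.punchOut-injective (λ e → miss (i , sym e)) (λ e → miss (i′ , sym e)) e)) i<i′)

  injective⇒surjective : ∀ f → (∀ {x y} → f x ≡ f y → x ≡ y) → ∀ y → ∃ λ x → f x ≡ y
  injective⇒surjective f f-injective y
    with fin-injective⇒surjective size (index ∘ f ∘ element) g-injective (index y)
    where
    g-injective : ∀ {i j} → index (f (element i)) ≡ index (f (element j)) → i ≡ j
    g-injective {i} {j} e = trans (sym (strictlyInverseˡ i))
      (trans (cong index (f-injective (index-injective e))) (strictlyInverseˡ j))
  ... | i , e = element i , index-injective e

  additive-injective : ∀ f → IsAdditive f → (∀ d → d ≢ 0# → f d ≢ 0#) → ∀ {x x′} → f x ≡ f x′ → x ≡ x′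
  additive-injective f f-additive f-nonzero {x} {x′} e with (x + - x′) ≟ 0#
  ... | yes d≡0 = x∙y⁻¹≈ε⇒x≈y x x′ d≡0
  ... | no d≢0 = ⊥-elim (f-nonzero (x + - x′) d≢0 (begin
        f (x + - x′)     ≡⟨ f-additive x (- x′) ⟩
        f x + f (- x′)   ≡⟨ cong₂ _+_ e (additive-neg f f-additive x′) ⟩
        f x′ + - f x′    ≡⟨ -‿inverseʳ (f x′) ⟩
        0#               ∎))

  additive-division : ∀ f → IsAdditive f → (∀ d → d ≢ 0# → f d ≢ 0#) →
    ∀ y → y ≢ 0# → Σ Carrier (λ x → x ≢ 0# × (f x ≡ y) × (∀ x′ → x′ ≢ 0# → f x′ ≡ y → x′ ≡ x))
  additive-division f f-additive f-nonzero y y≢0 with injective⇒surjective f (additive-injective f f-additive f-nonzero) y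
  ... | x , fx≡y = x , x≢0 , fx≡y ,
          (λ x′ _ fx′≡y → additive-injective f f-additive f-nonzero (trans fx′≡y (sym fx≡y)))
    where
    x≢0 : x ≢ 0#
    x≢0 x≡0 = y≢0 (trans (sym fx≡y) (trans (cong f x≡0) (additive-zero f f-additive)))

  module Trace (q n : ℕ) (frobenius-q : Additive q) (period : ∀ a → a ^ (q ^ℕ n) ≡ a) where

    InFq : Carrier → Set c
    InFq μ = μ ^ q ≡ μ

    Tr-additive : IsAdditive (Tr q n)
    Tr-additive x y = trans (sumK-cong n (λ i → additive-power frobenius-q (toℕ i) x y)) (sumK-+ n _ _)

    Tr-linear : ∀ μ w → InFq μ → Tr q n (μ * w) ≡ μ * Tr q n w
    Tr-linear μ w μ∈Fq = trans (sumK-cong n μ-factors) (sym (*-sumK n μ _))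
      where
      μ-factors : ∀ i → (μ * w) ^ (q ^ℕ toℕ i) ≡ μ * w ^ (q ^ℕ toℕ i)
      μ-factors i = trans (*-^ μ w (q ^ℕ toℕ i)) (cong (_* (w ^ (q ^ℕ toℕ i))) (fixed-power {a = q} μ∈Fq (toℕ i)))

    -- Tr(w)^q = Σ w^{q^{i+1}} is Tr(w) with its terms rotated, since w^{q^n} = w.
    Tr-InFq : ∀ w → InFq (Tr q n w)
    Tr-InFq w = begin
      Tr q n w ^ q                          ≡⟨ additive-sumK (_^ q) frobenius-q n _ ⟩
      sumK n (λ i → (w ^ (q ^ℕ toℕ i)) ^ q)  ≡⟨ sumK-cong n (λ i → sym (frobenius-step (toℕ i))) ⟩
      sumK n (g ∘ suc ∘ toℕ)                 ≡⟨ sym (+-cancelˡ (g 0) _ _ rotated) ⟩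
      Tr q n w                              ∎
      where
      g : ℕ → Carrier
      g j = w ^ (q ^ℕ j)
      frobenius-step : ∀ j → g (suc j) ≡ g j ^ q
      frobenius-step j = trans (cong (w ^_) (ℕP.*-comm q (q ^ℕ j))) (^-* w (q ^ℕ j) q)
      rotated : g 0 + Tr q n w ≡ g 0 + sumK n (g ∘ suc ∘ toℕ)
      rotated = begin
        g 0 + Tr q n w   ≡⟨ +-comm _ _ ⟩
        Tr q n w + g 0   ≡⟨ cong (Tr q n w +_) (trans (*-identityʳ w) (sym (period w))) ⟩
        Tr q n w + g n   ≡⟨ sumK-rotate n g ⟩
        g 0 + sumK n (g ∘ suc ∘ toℕ) ∎

    module TraceForm (b : Fin n → Carrier) where
      L : Carrier → Carrier
      L y = sumK n (λ i → b i * (y ^ (q ^ℕ toℕ i)))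

      B : Carrier → Carrier → Carrier
      B x y = Tr q n (sumK n (λ i → b i * x * (y ^ (q ^ℕ toℕ i))))

      B≡Tr[x·Ly] : ∀ x y → B x y ≡ Tr q n (x * L y)
      B≡Tr[x·Ly] x y = cong (Tr q n) (trans (sumK-cong n (λ i → xy∙z≈y∙xz (b i) x _))
                                            (sym (*-sumK n x _)))

      L-additive : IsAdditive L
      L-additive y z = trans (sumK-cong n (λ i → trans (cong (b i *_) (additive-power frobenius-q (toℕ i) y z)) (distribˡ _ _ _)))
                             (sumK-+ n _ _)

      L-linear : ∀ ν y → InFq ν → L (ν * y) ≡ ν * L y
      L-linear ν y ν∈Fq = trans (sumK-cong n ν-factors) (sym (*-sumK n ν _))
        where
        ν-factors : ∀ i → b i * ((ν * y) ^ (q ^ℕ toℕ i)) ≡ ν * (b i * (y ^ (q ^ℕ toℕ i)))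
        ν-factors i = begin
          b i * ((ν * y) ^ e)      ≡⟨ cong (b i *_) (*-^ ν y e) ⟩
          b i * (ν ^ e * y ^ e)    ≡⟨ cong (λ u → b i * (u * y ^ e)) (fixed-power {a = q} ν∈Fq (toℕ i)) ⟩
          b i * (ν * y ^ e)        ≡⟨ x∙yz≈y∙xz (b i) ν (y ^ e) ⟩
          ν * (b i * y ^ e)        ∎
          where e = q ^ℕ toℕ i

      B-additiveˡ : ∀ y → IsAdditive (λ x → B x y)
      B-additiveˡ y x x′ = begin
        B (x + x′) y                                ≡⟨ B≡Tr[x·Ly] (x + x′) y ⟩
        Tr q n ((x + x′) * L y)                     ≡⟨ cong (Tr q n) (distribʳ (L y) x x′) ⟩
        Tr q n (x * L y + x′ * L y)                 ≡⟨ Tr-additive _ _ ⟩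
        Tr q n (x * L y) + Tr q n (x′ * L y)        ≡⟨ sym (cong₂ _+_ (B≡Tr[x·Ly] x y) (B≡Tr[x·Ly] x′ y)) ⟩
        B x y + B x′ y                              ∎

      B-additiveʳ : ∀ x → IsAdditive (B x)
      B-additiveʳ x y y′ = begin
        B x (y + y′)                                ≡⟨ B≡Tr[x·Ly] x (y + y′) ⟩
        Tr q n (x * L (y + y′))                     ≡⟨ cong (λ u → Tr q n (x * u)) (L-additive y y′) ⟩
        Tr q n (x * (L y + L y′))                   ≡⟨ cong (Tr q n) (distribˡ x (L y) (L y′)) ⟩
        Tr q n (x * L y + x * L y′)                 ≡⟨ Tr-additive _ _ ⟩
        Tr q n (x * L y) + Tr q n (x * L y′)        ≡⟨ sym (cong₂ _+_ (B≡Tr[x·Ly] x y) (B≡Tr[x·Ly] x y′)) ⟩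
        B x y + B x y′                              ∎

      B-InFq : ∀ x y → InFq (B x y)
      B-InFq x y = Tr-InFq _

      B-linearʳ : ∀ ν x y → InFq ν → B x (ν * y) ≡ ν * B x y
      B-linearʳ ν x y ν∈Fq = begin
        B x (ν * y)                  ≡⟨ B≡Tr[x·Ly] x (ν * y) ⟩
        Tr q n (x * L (ν * y))       ≡⟨ cong (λ u → Tr q n (x * u)) (L-linear ν y ν∈Fq) ⟩
        Tr q n (x * (ν * L y))       ≡⟨ cong (Tr q n) (x∙yz≈y∙xz x ν (L y)) ⟩
        Tr q n (ν * (x * L y))       ≡⟨ Tr-linear ν (x * L y) ν∈Fq ⟩
        ν * Tr q n (x * L y)         ≡⟨ cong (ν *_) (sym (B≡Tr[x·Ly] x y)) ⟩
        ν * B x y                    ∎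

      Tr[M/a]≡B : ∀ ξ a → Tr q n (ξ * L a * a ⁻¹) ≡ B (ξ * a ⁻¹) a
      Tr[M/a]≡B ξ a = trans (cong (Tr q n) (xy∙z≈xz∙y ξ (L a) (a ⁻¹))) (sym (B≡Tr[x·Ly] (ξ * a ⁻¹) a))

  module TwistedProduct
      (B : Carrier → Carrier → Carrier)
      (B-additiveˡ : ∀ y → IsAdditive (λ x → B x y))
      (B-additiveʳ : ∀ x → IsAdditive (B x))
      (Scalar : Carrier → Set c)
      (B-scalar : ∀ x y → Scalar (B x y))
      (B-linearʳ : ∀ ν x y → Scalar ν → B x (ν * y) ≡ ν * B x y)
      (ξ : Carrier) (ξ≢0 : ξ ≢ 0#) where

    _⋆_ : Carrier → Carrier → Carrier
    x ⋆ y = x * y + B x y * ξ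

    Condition : Set c
    Condition = ∀ a → a ≢ 0# → B (ξ * a ⁻¹) a ≢ - 1#

    ⋆-additiveˡ : ∀ y → IsAdditive (_⋆ y)
    ⋆-additiveˡ y x x′ = trans (cong (λ u → (x + x′) * y + u * ξ) (B-additiveˡ y x x′))
      (solve 6 (λ x x′ y u v ξ → ((x ⊕ x′) ⊗ y ⊕ (u ⊕ v) ⊗ ξ) ⊜ ((x ⊗ y ⊕ u ⊗ ξ) ⊕ (x′ ⊗ y ⊕ v ⊗ ξ)))
        refl x x′ y (B x y) (B x′ y) ξ)

    ⋆-additiveʳ : ∀ x → IsAdditive (x ⋆_)
    ⋆-additiveʳ x y y′ = trans (cong (λ u → x * (y + y′) + u * ξ) (B-additiveʳ x y y′))
      (solve 6 (λ x y y′ u v ξ → (x ⊗ (y ⊕ y′) ⊕ (u ⊕ v) ⊗ ξ) ⊜ ((x ⊗ y ⊕ u ⊗ ξ) ⊕ (x ⊗ y′ ⊕ v ⊗ ξ)))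
        refl x y y′ (B x y) (B x y′) ξ)

    -- ξ/a multiplies a to ξ(1 + B(ξ/a, a)), which vanishes iff B(ξ/a, a) = -1.
    quotient-⋆ : ∀ a → a ≢ 0# → (ξ * a ⁻¹) ⋆ a ≡ ξ + B (ξ * a ⁻¹) a * ξ
    quotient-⋆ a a≢0 = cong (_+ B (ξ * a ⁻¹) a * ξ) (⁻¹-*-cancel a ξ a≢0)

    presemifield⇒condition : IsPresemifield K _⋆_ → Condition
    presemifield⇒condition presemifield a a≢0 B≡-1 =
      IsPresemifield.closed presemifield (ξ * a ⁻¹) a (no-zero-divisors ξ≢0 (⁻¹-nonzero a a≢0)) a≢0 (begin
        (ξ * a ⁻¹) ⋆ a             ≡⟨ quotient-⋆ a a≢0 ⟩
        ξ + B (ξ * a ⁻¹) a * ξ     ≡⟨ cong (λ u → ξ + u * ξ) B≡-1 ⟩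
        ξ + - 1# * ξ               ≡⟨ cong (ξ +_) (-1*x≈-x ξ) ⟩
        ξ + - ξ                    ≡⟨ -‿inverseʳ ξ ⟩
        0#                         ∎)

    -- Conversely, if a ⋆ y = 0 with a, y ≠ 0, put β = B(a,y) ≠ 0.  Then
    -- y = -β·(ξ/a) with -β = B(a,-y) a scalar, so β = -β·B(a, ξ/a) by
    -- linearity, i.e. B(a, ξ/a) = -1.
    zero-product⇒B≡-1 : ∀ a y → a ≢ 0# → y ≢ 0# → a ⋆ y ≡ 0# → B a (ξ * a ⁻¹) ≡ - 1#
    zero-product⇒B≡-1 a y a≢0 y≢0 a⋆y≡0 = +-inverseˡ-unique T 1# T+1≡0
      where
      β r T : Carrier
      β = B a y
      r = ξ * a ⁻¹
      T = B a r
      ay≡-βξ : a * y ≡ - (β * ξ)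
      ay≡-βξ = +-inverseˡ-unique (a * y) (β * ξ) a⋆y≡0
      β≢0 : β ≢ 0#
      β≢0 β≡0 = no-zero-divisors a≢0 y≢0 (begin
        a * y          ≡⟨ ay≡-βξ ⟩
        - (β * ξ)      ≡⟨ cong (λ u → - (u * ξ)) β≡0 ⟩
        - (0# * ξ)     ≡⟨ cong -_ (zeroˡ ξ) ⟩
        - 0#           ≡⟨ -0#≈0# ⟩
        0#             ∎)
      -β-scalar : Scalar (- β)
      -β-scalar = subst Scalar (additive-neg (B a) (B-additiveʳ a) y) (B-scalar a (- y))
      y≡-βc : y ≡ - β * r
      y≡-βc = begin
        y                   ≡⟨ sym (*-⁻¹-cancel a y a≢0) ⟩
        y * a * a ⁻¹        ≡⟨ cong (_* a ⁻¹) (trans (*-comm y a) ay≡-βξ) ⟩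
        - (β * ξ) * a ⁻¹    ≡⟨ cong (_* a ⁻¹) (-‿distribˡ-* β ξ) ⟩
        - β * ξ * a ⁻¹      ≡⟨ *-assoc (- β) ξ (a ⁻¹) ⟩
        - β * r             ∎
      β≡-βT : β ≡ - β * T
      β≡-βT = trans (cong (B a) y≡-βc) (B-linearʳ (- β) a r -β-scalar)
      T+1≡0 : T + 1# ≡ 0#
      T+1≡0 = *-cancelˡ β β≢0 (begin
        β * (T + 1#)          ≡⟨ distribˡ β T 1# ⟩
        β * T + β * 1#        ≡⟨ cong (β * T +_) (trans (*-identityʳ β) β≡-βT) ⟩
        β * T + - β * T       ≡⟨ cong (β * T +_) (sym (-‿distribˡ-* β T)) ⟩
        β * T + - (β * T)     ≡⟨ -‿inverseʳ (β * T) ⟩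
        0#                    ≡⟨ sym (zeroʳ β) ⟩
        β * 0#                ∎)

    -- Under the condition, ⋆ has no zero divisors: a zero product a ⋆ y
    -- would violate it at r = ξ/a, because ξ/r = a.
    condition⇒no-zero-divisors : Condition → ∀ a y → a ≢ 0# → y ≢ 0# → a ⋆ y ≢ 0#
    condition⇒no-zero-divisors condition a y a≢0 y≢0 a⋆y≡0 =
      condition (ξ * a ⁻¹) (no-zero-divisors ξ≢0 (⁻¹-nonzero a a≢0))
        (trans (cong (λ u → B u (ξ * a ⁻¹)) (ratio-inverse ξ a ξ≢0 a≢0)) (zero-product⇒B≡-1 a y a≢0 y≢0 a⋆y≡0))

    -- Divisions then exist uniquely because x ↦ a ⋆ x and x ↦ x ⋆ a are
    -- additive with trivial kernel.
    condition⇒presemifield : Condition → IsPresemifield K _⋆_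
    condition⇒presemifield condition = record
      { distribˡ = ⋆-additiveʳ
      ; distribʳ = ⋆-additiveˡ
      ; zeroˡ = λ a → additive-zero (_⋆ a) (⋆-additiveˡ a)
      ; zeroʳ = λ a → additive-zero (a ⋆_) (⋆-additiveʳ a)
      ; closed = no-zero-products
      ; leftDiv = λ a b a≢0 → additive-division (a ⋆_) (⋆-additiveʳ a) (λ x → no-zero-products a x a≢0) b
      ; rightDiv = λ a b a≢0 → additive-division (_⋆ a) (⋆-additiveˡ a) (λ x x≢0 → no-zero-products x a x≢0 a≢0) b
      }
      where
      no-zero-products : ∀ a y → a ≢ 0# → y ≢ 0# → a ⋆ y ≢ 0#
      no-zero-products = condition⇒no-zero-divisors condition

theorem2p1 : ∀ {c : Level} (p k n : ℕ) → Prime p → k ≥ 1 → n ≥ 1 →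
    (K : FiniteField c) → FiniteField.size K ≡ (p ^ℕ k) ^ℕ n →
    let open FiniteField K
        open FieldOps K
        q = p ^ℕ k
    in (b : Fin n → Carrier) (ξ : Carrier) → ξ ≢ 0# →
    let B : Carrier → Carrier → Carrier
        B x y = Tr q n (sumK n (λ i → b i * x * (y ^ (q ^ℕ toℕ i))))
        _⋆_ : Carrier → Carrier → Carrier
        x ⋆ y = x * y + B x y * ξ
        M : Carrier → Carrier
        M X = ξ * sumK n (λ i → b i * (X ^ (q ^ℕ toℕ i)))
    in IsPresemifield K _⋆_ ⇔ (∀ a → a ≢ 0# → Tr q n (M a * (a ⁻¹)) ≢ - 1#)
theorem2p1 p k n p-prime _ _ K size≡qⁿ b ξ ξ≢0 =
  mk⇔ (λ presemifield a a≢0 → presemifield⇒condition presemifield a a≢0 ∘ trans (sym (Tr[M/a]≡B ξ a)))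
      (λ condition → condition⇒presemifield (λ a a≢0 → condition a a≢0 ∘ trans (Tr[M/a]≡B ξ a)))
  where
  open FiniteField K
  open FieldOps K
  open FieldTheory K

  q : ℕ
  q = p ^ℕ k

  frobenius-q : Additive q
  frobenius-q = additive-power (frobenius p p-prime (characteristic p (k ℕ.* n) size≡pᵏⁿ)) k
    where
    size≡pᵏⁿ : size ≡ p ^ℕ (k ℕ.* n)
    size≡pᵏⁿ = trans size≡qⁿ (ℕP.^-*-assoc p k n)

  period : ∀ a → a ^ (q ^ℕ n) ≡ a
  period a = subst (λ e → a ^ e ≡ a) size≡qⁿ (fermat a)

  open Trace q n frobenius-q period
  open TraceForm b
  open TwistedProduct B B-additiveˡ B-additiveʳ InFq B-InFq B-linearʳ ξ ξ≢0
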